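{- Let $\mathcal{C}_3$ denote the set of integers occurring as a coordinate of some 3-color fair game, i.e. of some triple of non-negative integers $(x_1,x_2,x_3)$ with $(x_1+x_2+x_3)^2-(x_1+x_2+x_3)-4(x_1x_2+x_1x_3+x_2x_3)=0$. Let $P_1^{\ge 0}$ be the set of positive integers all of whose prime factors are congruent to $1$ modulo $3$ (including $1$). Then $$\mathcal{C}_3=\{c\ge 0:\ 2c+1\in P_1^{\ge 0}\cup 3P_1^{\ge 0}\}.$$
   Context: $3P_1^{\ge 0}=\{3k: k\in P_1^{\ge 0}\}$. -}

module Defs where

open import Data.Nat using (ℕ; _+_; _*_; _%_; _≥_)
open import Data.Nat.Divisibility using (_∣_)
open import Data.Nat.Primality using (Prime)
open import Data.Product using (_×_; ∃-syntax)
open import Data.Sum using (_⊎_)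
open import Relation.Binary.PropositionalEquality using (_≡_)

-- A 3-color fair game: a triple (x₁,x₂,x₃) of non-negative integers with
-- (x₁+x₂+x₃)² − (x₁+x₂+x₃) − 4(x₁x₂+x₁x₃+x₂x₃) = 0,
-- written over ℕ without subtraction as s² = s + 4e.
FairGame3 : ℕ → ℕ → ℕ → Set
FairGame3 x₁ x₂ x₃ =
  (x₁ + x₂ + x₃) * (x₁ + x₂ + x₃)
    ≡ (x₁ + x₂ + x₃) + 4 * (x₁ * x₂ + x₁ * x₃ + x₂ * x₃)

C₃ : ℕ → Set
C₃ c = ∃[ x ] (∃[ y ] (∃[ z ] (FairGame3 x y z × (c ≡ x ⊎ c ≡ y ⊎ c ≡ z))))

P₁ : ℕ → Set
P₁ n = n ≥ 1 × (∀ p → Prime p → p ∣ n → p % 3 ≡ 1)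

ThreeP₁ : ℕ → Set
ThreeP₁ m = ∃[ k ] (P₁ k × m ≡ 3 * k)

-- Writing s = y + z and t = y - z, the fair-game equation for (x, y, z) reads
-- s (2x + 1) + x = t² + x², or equivalently (2x + 1)(4s + 3 - 2x) = 4t² + 3. Hence c ∈ 𝒞₃
-- exactly when n = 2c + 1 divides a² + 3 for some a: conversely, a root a can be moved within
-- its class mod n until a = 2t with t ≥ n, and then the cofactor s has the parity and size of t.
--
-- For a prime p ≠ 2, 3, -3 is a square mod p iff p ≡ 1 (mod 3). A root a gives the primitive
-- cube root of unity ω = (a - 1)/2, and x ↦ ωx splits the nonzero residues into orbits of size 3,
-- so 3 ∣ p - 1. Conversely x ↦ 1/(1 - x) permutes {2, …, p - 1} with orbits of size 1 or 3; as
-- 3 ∤ p - 2 it has a fixed point x, and then (2x - 1)² ≡ -3. Square roots of -3 lift to products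
-- by the Chinese remainder theorem and by Hensel's lemma, and 9 never divides a² + 3; this leaves
-- exactly P₁ ∪ 3P₁ for the odd moduli n.

module Submission where

open import Data.Nat.Primality using (Prime)

module Orbits where

  open import Data.Nat using (ℕ; suc; _+_; _∸_; _≤_; _<_; s≤s)
  open import Data.Nat.Properties
    using (_≟_; m≤n+m; m≤m+n; <⇒≢; +-cancelˡ-≡; +-comm; m≤o∸n⇒m+n≤o; ∸-monoˡ-<; m+[n∸m]≡n)
  open import Data.Nat.Divisibility using (_∣_; _∣0; ∣m∣n⇒∣m+n; ∣-refl)
  open import Data.Nat.Induction using (<-rec)
  open import Data.List using (List; []; _∷_; length; filter; applyUpTo)
  open import Data.List.Properties using (filter-accept; filter-reject; filter-all; length-applyUpTo)
  open import Data.List.Relation.Unary.All as All using ()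
  open import Data.List.Relation.Unary.AllPairs using (_∷_)
  open import Data.List.Relation.Unary.Any using (here; there; any?)
  open import Data.List.Relation.Unary.Unique.Propositional using (Unique)
  import Data.List.Relation.Unary.Unique.Propositional.Properties as Unique
  open import Data.List.Membership.Propositional using (_∈_; find; lose)
  open import Data.List.Membership.Propositional.Properties
    using (∈-filter⁺; ∈-filter⁻; ∈-applyUpTo⁺; ∈-applyUpTo⁻)
  open import Data.Product using (_×_; _,_; proj₁; ∃-syntax)
  open import Data.Sum using (_⊎_; inj₁; inj₂)
  open import Function using (_∘′_)
  open import Relation.Binary.Definitions using (DecidableEquality)
  open import Relation.Binary.PropositionalEquality using (_≡_; _≢_; refl; sym; trans; cong; subst)
  open import Relation.Nullary using (¬?; yes; no)

  record FixedPointFreeOrder3 {a} {A : Set a} (f : A → A) (xs : List A) : Set a where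
    field
      closed         : ∀ {x} → x ∈ xs → f x ∈ xs
      cube≡id        : ∀ {x} → x ∈ xs → f (f (f x)) ≡ x
      fixedPointFree : ∀ {x} → x ∈ xs → f x ≢ x

  module _ {a} {A : Set a} (_≟_ : DecidableEquality A) where

    remove : A → List A → List A
    remove x = filter (λ y → ¬? (y ≟ x))

    ∈-remove⁺ : ∀ {x y xs} → y ∈ xs → y ≢ x → y ∈ remove x xs
    ∈-remove⁺ = ∈-filter⁺ (λ y → ¬? (y ≟ _))

    ∈-remove⁻ : ∀ {x y xs} → y ∈ remove x xs → y ∈ xs × y ≢ x
    ∈-remove⁻ = ∈-filter⁻ (λ y → ¬? (y ≟ _))

    remove-unique : ∀ {x xs} → Unique xs → Unique (remove x xs)
    remove-unique = Unique.filter⁺ (λ y → ¬? (y ≟ _))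

    length-remove : ∀ {x xs} → Unique xs → x ∈ xs → suc (length (remove x xs)) ≡ length xs
    length-remove {x} (x≢ys ∷ _) (here refl) =
      cong suc (trans (cong length (filter-reject (λ y → ¬? (y ≟ x)) (λ x≢x → x≢x refl)))
                      (cong length (filter-all (λ y → ¬? (y ≟ x))
                                                (All.map (λ x≢y y≡x → x≢y (sym y≡x)) x≢ys))))
    length-remove {x} {y ∷ _} (y≢ys ∷ u) (there x∈ys) =
      trans (cong (suc ∘′ length)
                  (filter-accept (λ z → ¬? (z ≟ x)) (λ y≡x → All.lookup y≢ys x∈ys y≡x)))
            (cong suc (length-remove u x∈ys))

    module _ {f : A → A} where

      FixedPointFreeOrder3-injective : ∀ {xs x y} → FixedPointFreeOrder3 f xs →
                                       x ∈ xs → y ∈ xs → f x ≡ f y → x ≡ y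
      FixedPointFreeOrder3-injective F x∈ y∈ fx≡fy =
        trans (sym (cube≡id x∈)) (trans (cong (λ z → f (f z)) fx≡fy) (cube≡id y∈))
        where open FixedPointFreeOrder3 F

      FixedPointFreeOrder3⇒3∣length : ∀ {xs} → Unique xs → FixedPointFreeOrder3 f xs → 3 ∣ length xs
      FixedPointFreeOrder3⇒3∣length {xs} = <-rec Motive step (length xs) xs refl
        where
        Motive : ℕ → Set a
        Motive n = ∀ xs → length xs ≡ n → Unique xs → FixedPointFreeOrder3 f xs → 3 ∣ n
        step : ∀ n → (∀ {m} → m < n → Motive m) → Motive n
        step n ih []           refl _ _ = 3 ∣0
        step n ih xs@(x ∷ _) refl u F =
          subst (3 ∣_) length-xs (∣m∣n⇒∣m+n ∣-refl (ih length-ys<length-xs ys refl u-ys F-ys))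
          where
          open FixedPointFreeOrder3 F
          injective : ∀ {y z} → y ∈ xs → z ∈ xs → f y ≡ f z → y ≡ z
          injective = FixedPointFreeOrder3-injective F
          x∈ : x ∈ xs
          x∈ = here refl
          fx∈ = closed x∈
          ffx∈ = closed fx∈
          fx≢x : f x ≢ x
          fx≢x = fixedPointFree x∈
          ffx≢x : f (f x) ≢ x
          ffx≢x ffx≡x = fx≢x (trans (cong f (sym ffx≡x)) (cube≡id x∈))
          xs₁ = remove x xs
          xs₂ = remove (f x) xs₁
          ys = remove (f (f x)) xs₂
          u₁ = remove-unique u
          u₂ = remove-unique u₁
          u-ys = remove-unique u₂
          length-xs : 3 + length ys ≡ length xs
          length-xs =
            trans (cong (2 +_) (length-remove u₂ (∈-remove⁺ (∈-remove⁺ ffx∈ ffx≢x) (fixedPointFree fx∈))))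
                  (trans (cong suc (length-remove u₁ (∈-remove⁺ fx∈ fx≢x))) (length-remove u x∈))
          length-ys<length-xs : length ys < length xs
          length-ys<length-xs = subst (length ys <_) length-xs (s≤s (m≤n+m (length ys) 2))
          ∈-ys⁻ : ∀ {y} → y ∈ ys → y ∈ xs × y ≢ x × y ≢ f x × y ≢ f (f x)
          ∈-ys⁻ y∈ys = let (y∈₂ , y≢ffx) = ∈-remove⁻ y∈ys
                           (y∈₁ , y≢fx)  = ∈-remove⁻ y∈₂
                           (y∈  , y≢x)   = ∈-remove⁻ y∈₁
                       in y∈ , y≢x , y≢fx , y≢ffx
          F-ys : FixedPointFreeOrder3 f ys
          F-ys = record
            { closed = λ y∈ys → let (y∈ , y≢x , y≢fx , y≢ffx) = ∈-ys⁻ y∈ys in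
                ∈-remove⁺ (∈-remove⁺ (∈-remove⁺ (closed y∈)
                  (λ fy≡x → y≢ffx (injective y∈ ffx∈ (trans fy≡x (sym (cube≡id x∈))))))
                  (λ fy≡fx → y≢x (injective y∈ x∈ fy≡fx)))
                  (λ fy≡ffx → y≢fx (injective y∈ fx∈ fy≡ffx))
            ; cube≡id = λ y∈ → cube≡id (proj₁ (∈-ys⁻ y∈))
            ; fixedPointFree = λ y∈ → fixedPointFree (proj₁ (∈-ys⁻ y∈))
            }

  module _ {lo hi : ℕ} (lo≤hi : lo ≤ hi) (f : ℕ → ℕ) where

    private
      interval : List ℕ
      interval = applyUpTo (lo +_) (hi ∸ lo)

      ∈-interval⁻ : ∀ {x} → x ∈ interval → lo ≤ x × x < hi
      ∈-interval⁻ x∈ with i , i<hi-lo , refl ← ∈-applyUpTo⁻ (lo +_) x∈ =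
        m≤m+n lo i , subst (_≤ hi) (cong suc (+-comm i lo)) (m≤o∸n⇒m+n≤o (suc i) lo≤hi i<hi-lo)

      ∈-interval⁺ : ∀ {x} → lo ≤ x → x < hi → x ∈ interval
      ∈-interval⁺ lo≤x x<hi =
        subst (_∈ interval) (m+[n∸m]≡n lo≤x) (∈-applyUpTo⁺ (lo +_) (∸-monoˡ-< x<hi lo≤x))

      interval-unique : Unique interval
      interval-unique =
        Unique.applyUpTo⁺₁ (lo +_) (hi ∸ lo)
          (λ i<j _ lo+i≡lo+j → <⇒≢ i<j (+-cancelˡ-≡ lo _ _ lo+i≡lo+j))

    order3⇒fixedPoint⊎3∣hi∸lo : (∀ {x} → lo ≤ x → x < hi → lo ≤ f x × f x < hi)
                              → (∀ {x} → lo ≤ x → x < hi → f (f (f x)) ≡ x)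
                              → (∃[ x ] lo ≤ x × x < hi × f x ≡ x) ⊎ 3 ∣ hi ∸ lo
    order3⇒fixedPoint⊎3∣hi∸lo closed cube≡id with any? (λ x → f x ≟ x) interval
    ... | yes fixedPoint =
      let (x , x∈ , fx≡x) = find fixedPoint
          (lo≤x , x<hi) = ∈-interval⁻ x∈
      in inj₁ (x , lo≤x , x<hi , fx≡x)
    ... | no noFixedPoint =
      inj₂ (subst (3 ∣_) (length-applyUpTo (lo +_) (hi ∸ lo))
        (FixedPointFreeOrder3⇒3∣length _≟_ interval-unique (record
          { closed = λ x∈ → let (lo≤x , x<hi) = ∈-interval⁻ x∈
                                (lo≤fx , fx<hi) = closed lo≤x x<hi
                            in ∈-interval⁺ lo≤fx fx<hi
          ; cube≡id = λ x∈ → let (lo≤x , x<hi) = ∈-interval⁻ x∈ in cube≡id lo≤x x<hi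
          ; fixedPointFree = λ x∈ fx≡x → noFixedPoint (lose x∈ fx≡x)
          })))

open Orbits using (order3⇒fixedPoint⊎3∣hi∸lo)

module SquareRootsOfMinus3 where

  open import Data.Nat using (ℕ; _+_; _*_)
  open import Data.Nat.Divisibility using (_∣_; ∣m∣n⇒∣m+n; m∣m*n; ∣-trans)
  open import Data.Nat.Primality using (prime?)
  open import Data.Nat.Tactic.RingSolver using (solve-∀)
  open import Data.Product using (∃-syntax; _,_)
  open import Data.Unit using (tt)
  open import Relation.Binary.PropositionalEquality using (_≡_; sym; subst)
  open import Relation.Nullary.Decidable using (toWitness)

  SqrtMinus3Mod : ℕ → Set
  SqrtMinus3Mod n = ∃[ a ] n ∣ a * a + 3

  SqrtMinus3Mod-∣ : ∀ {d n} → d ∣ n → SqrtMinus3Mod n → SqrtMinus3Mod d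
  SqrtMinus3Mod-∣ d∣n (a , n∣a²+3) = a , ∣-trans d∣n n∣a²+3

  sq+3-shift-identity : ∀ m a k → (a + m * k) * (a + m * k) + 3 ≡ (a * a + 3) + m * (2 * a * k + m * k * k)
  sq+3-shift-identity = solve-∀

  ∣sq+3-shift : ∀ m a k → m ∣ a * a + 3 → m ∣ (a + m * k) * (a + m * k) + 3
  ∣sq+3-shift m a k m∣a²+3 =
    subst (m ∣_) (sym (sq+3-shift-identity m a k)) (∣m∣n⇒∣m+n m∣a²+3 (m∣m*n _))

  prime-3 : Prime 3
  prime-3 = toWitness {a? = prime? 3} tt

open SquareRootsOfMinus3

module IntegerCongruences where

  open import Agda.Builtin.FromNat using (Number; fromNat)
  open import Data.Unit using (tt)
  open import Data.Integer as ℤ using (ℤ; +_; _+_; _*_; _-_; -_; _%ℕ_; _/ℕ_)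
  import Data.Integer.Literals as ℤ
  open import Data.Integer.DivMod using (n%ℕd<d; a≡a%ℕn+[a/ℕn]*n)
  open import Data.Integer.Properties
    using ( pos-+; pos-*; abs-*; neg-distribˡ-*; +-injective; i-j≡0⇒i≡j; ∣i∣≡0⇒i≡0
          ; m-n≡m⊖n; ⊖-≥; ∣m⊝n∣≤m⊔n)
  open import Data.Integer.Divisibility.Signed
    using (_∣_; divides; ∣ᵤ⇒∣; ∣⇒∣ᵤ; ∣-refl; ∣m∣n⇒∣m+n; ∣n⇒∣m*n)
  open import Data.Integer.Tactic.RingSolver using (solve-∀)
  open import Data.Nat using (ℕ; zero; suc)
  import Data.Nat as ℕ
  import Data.Nat.Literals as ℕ
  import Data.Nat.Properties as ℕ
  import Data.Nat.Divisibility as ℕ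
  import Data.Nat.Tactic.RingSolver as ℕ
  open import Data.Nat.DivMod using ([m+kn]%n≡m%n)
  open import Data.Nat.Coprimality using (Coprime; coprime-Bézout)
  open import Data.Nat.GCD using (module Bézout)
  open import Data.Nat.Primality
    using (¬prime[1]; prime[2]; euclidsLemma; prime⇒nonZero; prime⇒nonTrivial; prime⇒irreducible)
  open import Data.Empty using (⊥-elim)
  open import Data.Product using (∃-syntax; _×_; _,_; proj₁; proj₂)
  open import Data.Sum using (_⊎_; inj₁; inj₂; [_,_]′)
  open import Function using (_∘_; id)
  open import Relation.Nullary using (¬_; yes; no; contradiction)
  open import Relation.Binary.PropositionalEquality
    using (_≡_; _≢_; refl; sym; trans; cong; subst; module ≡-Reasoning)

  instance
    ℕ-number : Number ℕ
    ℕ-number = ℕ.number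
    ℤ-number : Number ℤ
    ℤ-number = ℤ.number

  module _ {d : ℤ} where

    ∣-combination₁ : ∀ {e h} c → e ≡ c * h → d ∣ h → d ∣ e
    ∣-combination₁ c refl d∣h = ∣n⇒∣m*n c d∣h

    ∣-combination₂ : ∀ {e h₁ h₂} c₁ c₂ → e ≡ c₁ * h₁ + c₂ * h₂ → d ∣ h₁ → d ∣ h₂ → d ∣ e
    ∣-combination₂ c₁ c₂ refl d∣h₁ d∣h₂ = ∣m∣n⇒∣m+n (∣n⇒∣m*n c₁ d∣h₁) (∣n⇒∣m*n c₂ d∣h₂)

    ∣-combination₃ : ∀ {e h₁ h₂ h₃} c₁ c₂ c₃ → e ≡ c₁ * h₁ + c₂ * h₂ + c₃ * h₃ →
                     d ∣ h₁ → d ∣ h₂ → d ∣ h₃ → d ∣ e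
    ∣-combination₃ c₁ c₂ c₃ refl d∣h₁ d∣h₂ d∣h₃ =
      ∣m∣n⇒∣m+n (∣-combination₂ c₁ c₂ refl d∣h₁ d∣h₂) (∣n⇒∣m*n c₃ d∣h₃)

  pos-+* : ∀ k m n → + (k ℕ.+ m ℕ.* n) ≡ + k + + m * + n
  pos-+* k m n = trans (pos-+ k (m ℕ.* n)) (cong (λ t → + k + t) (pos-* m n))

  pos-sq+3 : ∀ a → + (a ℕ.* a ℕ.+ 3) ≡ + a * + a + 3
  pos-sq+3 a = trans (pos-+ (a ℕ.* a) 3) (cong (_+ 3) (pos-* a a))

  pos-∸ : ∀ {m n} → n ℕ.≤ m → + (m ℕ.∸ n) ≡ + m - + n
  pos-∸ {m} {n} n≤m = sym (trans (m-n≡m⊖n m n) (⊖-≥ n≤m))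

  module ModPrime {p : ℕ} (prime : Prime p) where

    P : ℤ
    P = + p

    1<p : 1 ℕ.< p
    1<p = ℕ.nonTrivial⇒n>1 p {{prime⇒nonTrivial prime}}

    p∣q⇒p≡q : ∀ {q} → Prime q → p ℕ.∣ q → p ≡ q
    p∣q⇒p≡q prime-q p∣q with prime⇒irreducible prime-q p∣q
    ... | inj₁ refl = contradiction prime ¬prime[1]
    ... | inj₂ p≡q  = p≡q

    p≢q⇒p∤q : ∀ {q} → Prime q → p ≢ q → ¬ P ∣ + q
    p≢q⇒p∤q prime-q p≢q p∣q = p≢q (p∣q⇒p≡q prime-q (∣⇒∣ᵤ p∣q))

    p∣xy⇒p∣x⊎p∣y : ∀ x y → P ∣ x * y → P ∣ x ⊎ P ∣ y
    p∣xy⇒p∣x⊎p∣y x y p∣xy with euclidsLemma _ _ prime (subst (p ℕ.∣_) (abs-* x y) (∣⇒∣ᵤ p∣xy))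
    ... | inj₁ p∣x = inj₁ (∣ᵤ⇒∣ p∣x)
    ... | inj₂ p∣y = inj₂ (∣ᵤ⇒∣ p∣y)

    p∤n : ∀ {n} → .{{ℕ.NonZero n}} → n ℕ.< p → ¬ p ℕ.∣ n
    p∤n n<p p∣n = ℕ.<⇒≱ n<p (ℕ.∣⇒≤ p∣n)

    p∤+n : ∀ {n} → .{{ℕ.NonZero n}} → n ℕ.< p → ¬ P ∣ + n
    p∤+n n<p = p∤n n<p ∘ ∣⇒∣ᵤ

    p∤1 : ¬ P ∣ 1
    p∤1 = p∤+n 1<p

    p∣n<p⇒n≡0 : ∀ {n} → n ℕ.< p → p ℕ.∣ n → n ≡ 0
    p∣n<p⇒n≡0 {zero}  _   _   = refl
    p∣n<p⇒n≡0 {suc n} n<p p∣n = contradiction (ℕ.∣⇒≤ p∣n) (ℕ.<⇒≱ n<p)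

    p∣x-y⇒x≡y : ∀ {x y} → x ℕ.< p → y ℕ.< p → P ∣ + x - + y → x ≡ y
    p∣x-y⇒x≡y {x} {y} x<p y<p p∣x-y = +-injective (i-j≡0⇒i≡j (+ x) (+ y) x-y≡0)
      where
      x-y≡0 : + x - + y ≡ 0
      x-y≡0 = trans (m-n≡m⊖n x y) (∣i∣≡0⇒i≡0 (p∣n<p⇒n≡0
        (ℕ.≤-<-trans (∣m⊝n∣≤m⊔n x y) (ℕ.⊔-lub x<p y<p))
        (subst (λ z → p ℕ.∣ ℤ.∣ z ∣) (m-n≡m⊖n x y) (∣⇒∣ᵤ p∣x-y))))

    reduce : ℤ → ℕ
    reduce z = _%ℕ_ z p {{prime⇒nonZero prime}}

    reduce<p : ∀ z → reduce z ℕ.< p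
    reduce<p z = n%ℕd<d z p {{prime⇒nonZero prime}}

    p∣reduce[z]-z : ∀ z → P ∣ + reduce z - z
    p∣reduce[z]-z z = divides (- (z /ℕ p)) (begin
      + reduce z - z                          ≡⟨ cong (λ t → + reduce z - t) (a≡a%ℕn+[a/ℕn]*n z p) ⟩
      + reduce z - (+ reduce z + z /ℕ p * P)  ≡⟨ cancel (+ reduce z) (z /ℕ p) P ⟩
      - (z /ℕ p) * P                          ∎)
      where
      instance
        p-nonZero : ℕ.NonZero p
        p-nonZero = prime⇒nonZero prime
      open ≡-Reasoning
      cancel : ∀ r q d → r - (r + q * d) ≡ - q * d
      cancel = solve-∀

    coprime : ∀ {b} → ¬ p ℕ.∣ b → Coprime p b
    coprime p∤b (d∣p , d∣b) with prime⇒irreducible prime d∣p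
    ... | inj₁ d≡1 = d≡1
    ... | inj₂ refl = contradiction d∣b p∤b

    ∃-inverse : ∀ {b} → ¬ p ℕ.∣ b → ∃[ y ] P ∣ y * + b - 1
    ∃-inverse {b} p∤b with coprime-Bézout (coprime p∤b)
    ... | Bézout.+- x y 1+yb≡xp = - + y , divides (- + x) (begin
      - + y * + b - 1    ≡⟨ negate (+ y) (+ b) ⟩
      - (1 + + y * + b)  ≡⟨ cong -_ (trans (sym (pos-+* 1 y b)) (trans (cong +_ 1+yb≡xp) (pos-* x p))) ⟩
      - (+ x * P)        ≡⟨ neg-distribˡ-* (+ x) P ⟩
      - + x * P          ∎)
      where
      open ≡-Reasoning
      negate : ∀ y b → - y * b - 1 ≡ - (1 + y * b)
      negate = solve-∀
    ... | Bézout.-+ x y 1+xp≡yb = + y , divides (+ x) (begin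
      + y * + b - 1      ≡⟨ cong (_- 1) (trans (sym (pos-* y b)) (trans (cong +_ (sym 1+xp≡yb)) (pos-+* 1 x p))) ⟩
      1 + + x * P - 1    ≡⟨ cancel (+ x * P) ⟩
      + x * P            ∎)
      where
      open ≡-Reasoning
      cancel : ∀ z → 1 + z - 1 ≡ z
      cancel = solve-∀

    ∃-linear-solution : ∀ {u} → ¬ p ℕ.∣ u → ∀ v → ∃[ j ] P ∣ v + + u * + j
    ∃-linear-solution {u} p∤u v =
      let (y , p∣yu-1) = ∃-inverse p∤u
          k = - (y * v)
      in reduce k , ∣-combination₂ (+ u) (- v) (identity (+ u) (+ reduce k) v y) (p∣reduce[z]-z k) p∣yu-1
      where
      identity : ∀ u j v y → v + u * j ≡ u * (j - - (y * v)) + - v * (y * u - 1)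
      identity = solve-∀

    -- A total inverse, with junk value 0 at the multiples of p.
    inverse : ℕ → ℕ
    inverse b with p ℕ.∣? b
    ... | yes _   = 0
    ... | no p∤b  = reduce (proj₁ (∃-inverse p∤b))

    inverse<p : ∀ b → inverse b ℕ.< p
    inverse<p b with p ℕ.∣? b
    ... | yes _   = ℕ.<-trans ℕ.z<s 1<p
    ... | no p∤b  = reduce<p (proj₁ (∃-inverse p∤b))

    inverse-inverts : ∀ {b} → ¬ p ℕ.∣ b → P ∣ + inverse b * + b - 1
    inverse-inverts {b} p∤b with p ℕ.∣? b
    ... | yes p∣b = contradiction p∣b p∤b
    ... | no p∤b′ =
      let (y , p∣yb-1) = ∃-inverse p∤b′
      in ∣-combination₂ (+ b) 1 (identity (+ reduce y) y (+ b)) (p∣reduce[z]-z y) p∣yb-1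
      where
      identity : ∀ r y b → r * b - 1 ≡ b * (r - y) + 1 * (y * b - 1)
      identity = solve-∀

    module PrimitiveCubeRootOfUnity {W : ℤ} (p∣Φ₃[W] : P ∣ W * W + W + 1) where

      p∤W : ¬ P ∣ W
      p∤W p∣W = p∤1 (∣-combination₂ 1 (- (W + 1)) (identity W) p∣Φ₃[W] p∣W)
        where
        identity : ∀ W → 1 ≡ 1 * (W * W + W + 1) + - (W + 1) * W
        identity = solve-∀

      p∣W³-1 : P ∣ W * W * W - 1
      p∣W³-1 = ∣-combination₁ (W - 1) (identity W) p∣Φ₃[W]
        where
        identity : ∀ W → W * W * W - 1 ≡ (W - 1) * (W * W + W + 1)
        identity = solve-∀

      p∤W-1 : p ≢ 3 → ¬ P ∣ W - 1
      p∤W-1 p≢3 p∣W-1 =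
        p≢q⇒p∤q prime-3 p≢3 (∣-combination₂ 1 (- (W + 2)) (identity W) p∣Φ₃[W] p∣W-1)
        where
        identity : ∀ W → 3 ≡ 1 * (W * W + W + 1) + - (W + 2) * (W - 1)
        identity = solve-∀

      rotate : ℕ → ℕ
      rotate x = reduce (W * + x)

      rotate<p : ∀ x → rotate x ℕ.< p
      rotate<p x = reduce<p (W * + x)

      p∣rotate[x]-Wx : ∀ x → P ∣ + rotate x - W * + x
      p∣rotate[x]-Wx x = p∣reduce[z]-z (W * + x)

      rotate³≡id : ∀ {x} → x ℕ.< p → rotate (rotate (rotate x)) ≡ x
      rotate³≡id {x} x<p = p∣x-y⇒x≡y (rotate<p (rotate (rotate x))) x<p
        (∣-combination₂ 1 (+ x) (identity₂ V (+ x) W) p∣V-W³x p∣W³-1)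
        where
        Y = + rotate x
        Z = + rotate (rotate x)
        V = + rotate (rotate (rotate x))
        identity₁ : ∀ V Z Y X W → V - W * W * W * X ≡ 1 * (V - W * Z) + W * (Z - W * Y) + (W * W) * (Y - W * X)
        identity₁ = solve-∀
        identity₂ : ∀ V X W → V - X ≡ 1 * (V - W * W * W * X) + X * (W * W * W - 1)
        identity₂ = solve-∀
        p∣V-W³x : P ∣ V - W * W * W * + x
        p∣V-W³x = ∣-combination₃ 1 W (W * W) (identity₁ V Z Y (+ x) W)
          (p∣rotate[x]-Wx (rotate (rotate x))) (p∣rotate[x]-Wx (rotate x)) (p∣rotate[x]-Wx x)

      rotate-nonZero : ∀ {x} → .{{ℕ.NonZero x}} → x ℕ.< p → rotate x ≢ 0
      rotate-nonZero {x} x<p rotate[x]≡0 = [ p∤W , p∤+n x<p ]′ (p∣xy⇒p∣x⊎p∣y W (+ x) p∣Wx)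
        where
        -- + 0 rather than the literal 0, so that this matches the goal syntactically; otherwise
        -- unification unfolds the products in ℤ and becomes very slow.
        identity : ∀ W X → W * X ≡ - 1 * (+ 0 - W * X)
        identity = solve-∀
        p∣Wx : P ∣ W * + x
        p∣Wx = ∣-combination₁ (- 1) (identity W (+ x))
          (subst (λ r → P ∣ + r - W * + x) rotate[x]≡0 (p∣rotate[x]-Wx x))

      rotate-fixedPointFree : p ≢ 3 → ∀ {x} → .{{ℕ.NonZero x}} → x ℕ.< p → rotate x ≢ x
      rotate-fixedPointFree p≢3 {x} x<p rotate[x]≡x =
        [ p∤W-1 p≢3 , p∤+n x<p ]′ (p∣xy⇒p∣x⊎p∣y (W - 1) (+ x) p∣[W-1]x)
        where
        identity : ∀ W X → (W - 1) * X ≡ - 1 * (X - W * X)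
        identity = solve-∀
        p∣[W-1]x : P ∣ (W - 1) * + x
        p∣[W-1]x = ∣-combination₁ (- 1) (identity W (+ x))
          (subst (λ r → P ∣ + r - W * + x) rotate[x]≡x (p∣rotate[x]-Wx x))

      3∣p-1 : p ≢ 3 → 3 ℕ.∣ p ℕ.∸ 1
      3∣p-1 p≢3 = [ ⊥-elim ∘ noFixedPoint , id ]′
        (order3⇒fixedPoint⊎3∣hi∸lo (ℕ.<⇒≤ 1<p) rotate
          (λ {x} 1≤x x<p → ℕ.n≢0⇒n>0 (rotate-nonZero {{ℕ.>-nonZero 1≤x}} x<p) , rotate<p x)
          (λ _ x<p → rotate³≡id x<p))
        where
        noFixedPoint : ¬ (∃[ x ] 1 ℕ.≤ x × x ℕ.< p × rotate x ≡ x)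
        noFixedPoint (x , 1≤x , x<p , rotate[x]≡x) =
          rotate-fixedPointFree p≢3 {{ℕ.>-nonZero 1≤x}} x<p rotate[x]≡x

    ∃-primitive-cube-root : p ≢ 2 → SqrtMinus3Mod p → ∃[ W ] P ∣ W * W + W + 1
    ∃-primitive-cube-root p≢2 (a , p∣a²+3) =
      let (I , p∣2I-1) = ∃-inverse (p≢2 ∘ p∣q⇒p≡q prime[2])
      in I * (+ a - 1) , Φ₃-root (+ a) I (subst (P ∣_) (pos-sq+3 a) (∣ᵤ⇒∣ p∣a²+3)) p∣2I-1
      where
      p∤2 : ¬ P ∣ 2
      p∤2 = p≢q⇒p∤q prime[2] p≢2
      -- W = (A - 1) / 2 satisfies 4 (W² + W + 1) = A² + 3.
      Φ₃-root : ∀ A I → P ∣ A * A + 3 → P ∣ I * 2 - 1 → P ∣ I * (A - 1) * (I * (A - 1)) + I * (A - 1) + 1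
      Φ₃-root A I p∣A²+3 p∣2I-1 =
        [ ⊥-elim ∘ [ p∤2 , p∤2 ]′ ∘ p∣xy⇒p∣x⊎p∣y 2 2 , id ]′ (p∣xy⇒p∣x⊎p∣y 4 _ p∣4Φ₃)
        where
        identity₁ : ∀ A I → 2 * (I * (A - 1)) - A + 1 ≡ (A - 1) * (I * 2 - 1)
        identity₁ = solve-∀
        identity₂ : ∀ A W → 4 * (W * W + W + 1) ≡ 1 * (A * A + 3) + (2 * W + A + 1) * (2 * W - A + 1)
        identity₂ = solve-∀
        p∣4Φ₃ : P ∣ 4 * (I * (A - 1) * (I * (A - 1)) + I * (A - 1) + 1)
        p∣4Φ₃ = ∣-combination₂ 1 (2 * (I * (A - 1)) + A + 1) (identity₂ A (I * (A - 1))) p∣A²+3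
                  (∣-combination₁ (A - 1) (identity₁ A I) p∣2I-1)

    SqrtMinus3Mod⇒≡1mod3 : p ≢ 2 → p ≢ 3 → SqrtMinus3Mod p → p ℕ.% 3 ≡ 1
    SqrtMinus3Mod⇒≡1mod3 p≢2 p≢3 root =
      let (W , p∣Φ₃[W]) = ∃-primitive-cube-root p≢2 root
          ℕ.divides q p-1≡q*3 = PrimitiveCubeRootOfUnity.3∣p-1 {W} p∣Φ₃[W] p≢3
      in trans (cong (ℕ._% 3) (trans (sym (ℕ.m+[n∸m]≡n (ℕ.<⇒≤ 1<p))) (cong (1 ℕ.+_) p-1≡q*3)))
               ([m+kn]%n≡m%n 1 q 3)

    Inverts : ℕ → ℕ → Set
    Inverts x y = P ∣ + y * (1 - + x) - 1

    Inverts-cycle : ∀ {x y z w} → x ℕ.< p → w ℕ.< p → Inverts x y → Inverts y z → Inverts z w → w ≡ x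
    Inverts-cycle {x} {y} {z} {w} x<p w<p xy yz zw =
      [ p∣x-y⇒x≡y w<p x<p , ⊥-elim ∘ p∤1 ∘ ∣-combination₂ (- 1) W (identity₃ W Z) zw ]′
        (p∣xy⇒p∣x⊎p∣y (W - X) (1 - Z) p∣[w-x][1-z])
      where
      X = + x
      Z = + z
      W = + w
      identity₁ : ∀ X Y Z → X * (1 - Z) - 1 ≡ (1 - X) * (Z * (1 - Y) - 1) + Z * (Y * (1 - X) - 1)
      identity₁ = solve-∀
      identity₂ : ∀ X Z W → (W - X) * (1 - Z) ≡ 1 * (W * (1 - Z) - 1) + - 1 * (X * (1 - Z) - 1)
      identity₂ = solve-∀
      identity₃ : ∀ W Z → 1 ≡ - 1 * (W * (1 - Z) - 1) + W * (1 - Z)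
      identity₃ = solve-∀
      p∣[w-x][1-z] : P ∣ (W - X) * (1 - Z)
      p∣[w-x][1-z] = ∣-combination₂ 1 (- 1) (identity₂ X Z W) zw
        (∣-combination₂ (1 - X) Z (identity₁ X (+ y) Z) yz xy)

    -- σ x ≡ 1 / (1 - x) (mod p), as suc p ∸ x represents 1 - x.
    σ : ℕ → ℕ
    σ x = inverse (suc p ℕ.∸ x)

    module _ {x} (2≤x : 2 ℕ.≤ x) (x<p : x ℕ.< p) where

      σ-inverts : Inverts x (σ x)
      σ-inverts = ∣-combination₂ 1 (- Y) (identity Y (+ x) P) p∣Y[1+P-X]-1 ∣-refl
        where
        x≤1+p = ℕ.≤-trans (ℕ.<⇒≤ x<p) (ℕ.n≤1+n p)
        b = suc p ℕ.∸ x
        1<b : 1 ℕ.< b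
        1<b = subst (ℕ._< b) (ℕ.m+n∸n≡m 1 p) (ℕ.∸-monoʳ-< x<p (ℕ.n≤1+n p))
        b<p : b ℕ.< p
        b<p = ℕ.∸-monoʳ-< 2≤x x≤1+p
        Y = + σ x
        p∣Y[1+P-X]-1 : P ∣ Y * (1 + P - + x) - 1
        p∣Y[1+P-X]-1 = subst (λ B → P ∣ Y * B - 1) (trans (pos-∸ x≤1+p) (cong (_- + x) (pos-+ 1 p)))
          (inverse-inverts (p∤n {{ℕ.>-nonZero (ℕ.<-trans ℕ.z<s 1<b)}} b<p))
        identity : ∀ Y X P → Y * (1 - X) - 1 ≡ 1 * (Y * (1 + P - X) - 1) + - Y * P
        identity = solve-∀

      2≤σ : 2 ℕ.≤ σ x
      2≤σ = ℕ.≤∧≢⇒< (ℕ.n≢0⇒n>0 σ≢0) (σ≢1 ∘ sym)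
        where
        identity₀ : ∀ X → 1 ≡ - 1 * (+ 0 * (1 - X) - 1)
        identity₀ = solve-∀
        identity₁ : ∀ X → X ≡ - 1 * (+ 1 * (1 - X) - 1)
        identity₁ = solve-∀
        σ≢0 : σ x ≢ 0
        σ≢0 σ≡0 = p∤1 (∣-combination₁ (- 1) (identity₀ (+ x)) (subst (Inverts x) σ≡0 σ-inverts))
        σ≢1 : σ x ≢ 1
        σ≢1 σ≡1 = p∤+n {{ℕ.>-nonZero (ℕ.<-trans ℕ.z<s 2≤x)}} x<p
          (∣-combination₁ (- 1) (identity₁ (+ x)) (subst (Inverts x) σ≡1 σ-inverts))

    Inverts-self⇒SqrtMinus3Mod : ∀ {x} → 1 ℕ.≤ x → Inverts x x → SqrtMinus3Mod p
    Inverts-self⇒SqrtMinus3Mod {x} 1≤x xx =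
      a , ∣⇒∣ᵤ (subst (P ∣_) (sym +[a²+3]) (∣-combination₁ (- 4) (identity (+ x)) xx))
      where
      a = x ℕ.+ x ℕ.∸ 1
      +[a²+3] : + (a ℕ.* a ℕ.+ 3) ≡ (+ x + + x - 1) * (+ x + + x - 1) + 3
      +[a²+3] = trans (pos-sq+3 a) (cong (λ A → A * A + 3)
        (trans (pos-∸ (ℕ.≤-trans 1≤x (ℕ.m≤m+n x x))) (cong (_- 1) (pos-+ x x))))
      identity : ∀ X → (X + X - 1) * (X + X - 1) + 3 ≡ - 4 * (X * (1 - X) - 1)
      identity = solve-∀

    ≡1mod3⇒SqrtMinus3Mod : p ℕ.% 3 ≡ 1 → SqrtMinus3Mod p
    ≡1mod3⇒SqrtMinus3Mod p≡1[3] = [ fixedPoint , ⊥-elim ∘ 3∤p-2 ]′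
      (order3⇒fixedPoint⊎3∣hi∸lo 1<p σ (λ 2≤x x<p → 2≤σ 2≤x x<p , inverse<p _) σ³≡id)
      where
      fixedPoint : ∃[ x ] 2 ℕ.≤ x × x ℕ.< p × σ x ≡ x → SqrtMinus3Mod p
      fixedPoint (x , 2≤x , x<p , σx≡x) =
        Inverts-self⇒SqrtMinus3Mod (ℕ.<⇒≤ 2≤x) (subst (Inverts x) σx≡x (σ-inverts 2≤x x<p))
      σ³≡id : ∀ {x} → 2 ℕ.≤ x → x ℕ.< p → σ (σ (σ x)) ≡ x
      σ³≡id {x} 2≤x x<p =
        Inverts-cycle {x} {σ x} {σ (σ x)} x<p (inverse<p _) (σ-inverts 2≤x x<p) (σ-inverts 2≤σx (inverse<p _))
          (σ-inverts (2≤σ 2≤σx (inverse<p _)) (inverse<p _))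
        where 2≤σx = 2≤σ 2≤x x<p
      2≢1 : 2 ≢ 1
      2≢1 ()
      3∤p-2 : ¬ 3 ℕ.∣ p ℕ.∸ 2
      3∤p-2 (ℕ.divides q p-2≡q*3) =
        2≢1 (trans (sym (trans (cong (ℕ._% 3) p≡2+q*3) ([m+kn]%n≡m%n 2 q 3))) p≡1[3])
        where
        p≡2+q*3 : p ≡ 2 ℕ.+ q ℕ.* 3
        p≡2+q*3 = trans (sym (ℕ.m+[n∸m]≡n 1<p)) (cong (2 ℕ.+_) p-2≡q*3)

    -- c ≡ a (mod m) and c ≡ b (mod p).
    SqrtMinus3Mod-*-coprime : ∀ {m} → ¬ p ℕ.∣ m →
                              SqrtMinus3Mod p → SqrtMinus3Mod m → SqrtMinus3Mod (p ℕ.* m)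
    SqrtMinus3Mod-*-coprime {m} p∤m (b , p∣b²+3) (a , m∣a²+3) =
      c , pm∣ (∣sq+3-shift m a j m∣a²+3) (∣⇒∣ᵤ (subst (P ∣_) (sym +[c²+3]) p∣C²+3))
      where
      A = + a
      B = + b
      M = + m
      solution = ∃-linear-solution p∤m (A - B)
      j = proj₁ solution
      J = + j
      c = a ℕ.+ m ℕ.* j
      +[c²+3] : + (c ℕ.* c ℕ.+ 3) ≡ (A + M * J) * (A + M * J) + 3
      +[c²+3] = trans (pos-sq+3 c) (cong (λ C → C * C + 3) (pos-+* a m j))
      identity : ∀ A B M J → (A + M * J) * (A + M * J) + 3 ≡ 1 * (B * B + 3) + (A + M * J + B) * ((A - B) + M * J)
      identity = solve-∀
      p∣C²+3 : P ∣ (A + M * J) * (A + M * J) + 3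
      p∣C²+3 = ∣-combination₂ 1 (A + M * J + B) (identity A B M J)
        (subst (P ∣_) (pos-sq+3 b) (∣ᵤ⇒∣ p∣b²+3)) (proj₂ solution)
      pm∣ : ∀ {X} → m ℕ.∣ X → p ℕ.∣ X → p ℕ.* m ℕ.∣ X
      pm∣ (ℕ.divides r X≡rm) p∣X =
        [ (λ p∣r → subst (p ℕ.* m ℕ.∣_) (sym X≡rm) (ℕ.*-monoˡ-∣ m p∣r)) , ⊥-elim ∘ p∤m ]′
          (euclidsLemma r m prime (subst (p ℕ.∣_) X≡rm p∣X))

    -- c = a + m j with p ∣ (a² + 3) / m + 2 a j, so that p m ∣ c² + 3.
    SqrtMinus3Mod-*-dividing : ∀ {m} → p ≢ 2 → p ≢ 3 → p ℕ.∣ m →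
                               SqrtMinus3Mod m → SqrtMinus3Mod (p ℕ.* m)
    SqrtMinus3Mod-*-dividing {m} p≢2 p≢3 p∣m (a , ℕ.divides q a²+3≡qm) =
      c , subst (p ℕ.* m ℕ.∣_) (sym c²+3≡rm) (ℕ.*-monoˡ-∣ m p∣r)
      where
      A = + a
      p∤a : ¬ P ∣ A
      p∤a p∣a = p≢q⇒p∤q prime-3 p≢3 (∣-combination₂ 1 (- A) (identity A)
        (subst (P ∣_) (pos-sq+3 a) (∣ᵤ⇒∣ (ℕ.∣-trans p∣m (ℕ.divides q a²+3≡qm)))) p∣a)
        where
        identity : ∀ A → 3 ≡ 1 * (A * A + 3) + - A * A
        identity = solve-∀
      p∤2a : ¬ p ℕ.∣ 2 ℕ.* a
      p∤2a p∣2a = [ p≢q⇒p∤q prime[2] p≢2 , p∤a ]′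
        (p∣xy⇒p∣x⊎p∣y 2 A (subst (P ∣_) (pos-* 2 a) (∣ᵤ⇒∣ p∣2a)))
      solution = ∃-linear-solution p∤2a (+ q)
      j = proj₁ solution
      c = a ℕ.+ m ℕ.* j
      s = 2 ℕ.* a ℕ.* j ℕ.+ m ℕ.* j ℕ.* j
      r = q ℕ.+ 2 ℕ.* a ℕ.* j ℕ.+ m ℕ.* j ℕ.* j
      c²+3≡rm : c ℕ.* c ℕ.+ 3 ≡ r ℕ.* m
      c²+3≡rm = begin
        c ℕ.* c ℕ.+ 3            ≡⟨ sq+3-shift-identity m a j ⟩
        a ℕ.* a ℕ.+ 3 ℕ.+ m ℕ.* s  ≡⟨ cong (ℕ._+ m ℕ.* s) a²+3≡qm ⟩
        q ℕ.* m ℕ.+ m ℕ.* s        ≡⟨ identity q m a j ⟩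
        r ℕ.* m                  ∎
        where
        open ≡-Reasoning
        identity : ∀ q m a j → q ℕ.* m ℕ.+ m ℕ.* (2 ℕ.* a ℕ.* j ℕ.+ m ℕ.* j ℕ.* j)
                             ≡ (q ℕ.+ 2 ℕ.* a ℕ.* j ℕ.+ m ℕ.* j ℕ.* j) ℕ.* m
        identity = ℕ.solve-∀
      p∣r : p ℕ.∣ r
      p∣r = ℕ.∣m∣n⇒∣m+n (∣⇒∣ᵤ (subst (P ∣_) (sym (pos-+* q (2 ℕ.* a) j)) (proj₂ solution)))
                        (ℕ.∣m⇒∣m*n j (ℕ.∣m⇒∣m*n j p∣m))

    SqrtMinus3Mod-* : ∀ {m} → p ≢ 2 → p ≢ 3 →
                      SqrtMinus3Mod p → SqrtMinus3Mod m → SqrtMinus3Mod (p ℕ.* m)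
    SqrtMinus3Mod-* {m} p≢2 p≢3 root-p root-m with p ℕ.∣? m
    ... | yes p∣m = SqrtMinus3Mod-*-dividing p≢2 p≢3 p∣m root-m
    ... | no  p∤m = SqrtMinus3Mod-*-coprime p∤m root-p root-m

open IntegerCongruences using (module ModPrime)

open import Defs
open import Data.Nat using (ℕ; zero; suc; NonZero; >-nonZero; _+_; _*_; _%_; _≤_; s≤s; z≤n)
open import Data.Nat.Properties
  using (_≟_; +-comm; *-comm; +-cancelʳ-≡; +-cancelʳ-≤; *-cancelʳ-≤; +-mono-≤; *-monoʳ-≤; ≤-total;
         m≤m*n; m≤n+m; m≤n⇒∃[o]m+o≡n; n≢0⇒n>0; m+1+n≢0; module ≤-Reasoning)
open import Data.Nat.Divisibility
  using (_∣_; _∣?_; divides; _∣0; 1∣_; ∣-refl; ∣-trans; ∣m∣n⇒∣m+n; ∣m+n∣m⇒∣n; m∣m*n; n∣m*n; ∣n⇒∣m*n;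
         *-monoˡ-∣; ∣⇒≤)
open import Data.Nat.Primality using (euclidsLemma)
open import Data.Nat.Primality.Factorisation using (PrimeFactorisation; factorise)
open import Data.Nat.ListAction using (product)
open import Data.Nat.ListAction.Properties using (∈⇒∣product)
open import Data.Nat.Tactic.RingSolver using (solve-∀)
open import Data.List.Relation.Unary.All as All using (All; []; _∷_)
open import Data.List.Relation.Unary.Any using (here; there)
open import Data.List.Membership.Propositional using (_∈_)
open import Data.Empty using (⊥-elim)
open import Data.Product using (∃-syntax; _,_)
open import Data.Sum using (_⊎_; inj₁; inj₂; [_,_]′)
open import Function using (_∘_; id)
open import Function.Bundles using (_⇔_; mk⇔)
open import Relation.Nullary using (¬_; yes; no; contradiction)
open import Relation.Binary.PropositionalEquality
  using (_≡_; _≢_; refl; sym; trans; cong; subst; module ≡-Reasoning)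

2∣n*[1+n] : ∀ n → 2 ∣ n * suc n
2∣n*[1+n] zero    = 2 ∣0
2∣n*[1+n] (suc n) = subst (2 ∣_) (sym (identity n)) (∣m∣n⇒∣m+n (2∣n*[1+n] n) (m∣m*n (suc n)))
  where
  identity : ∀ n → suc n * suc (suc n) ≡ n * suc n + 2 * suc n
  identity = solve-∀

2∤odd : ∀ c → ¬ 2 ∣ 2 * c + 1
2∤odd c 2∣2c+1 = contradiction (∣⇒≤ (∣m+n∣m⇒∣n 2∣2c+1 (m∣m*n c))) λ { (s≤s ()) }

odd-nonZero : ∀ c → NonZero (2 * c + 1)
odd-nonZero c = >-nonZero (m≤n+m 1 (2 * c))

-- 4 (c + 1)² ≡ 1 (mod 2c + 1).
odd∣4x⇒∣x : ∀ c {x} → 2 * c + 1 ∣ 4 * x → 2 * c + 1 ∣ x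
odd∣4x⇒∣x c {x} n∣4x =
  ∣m+n∣m⇒∣n (subst (2 * c + 1 ∣_) (identity c x) (∣n⇒∣m*n (suc c * suc c) n∣4x)) (m∣m*n _)
  where
  identity : ∀ c x → suc c * suc c * (4 * x) ≡ (2 * c + 1) * ((2 * c + 3) * x) + x
  identity = solve-∀

-- Fair games and square roots of -3 modulo 2c + 1

FairGame3-swap₁₂ : ∀ x y z → FairGame3 x y z → FairGame3 y x z
FairGame3-swap₁₂ x y z game = trans (sym (lhs x y z)) (trans game (rhs x y z))
  where
  lhs : ∀ x y z → (x + y + z) * (x + y + z) ≡ (y + x + z) * (y + x + z)
  lhs = solve-∀
  rhs : ∀ x y z → (x + y + z) + 4 * (x * y + x * z + y * z) ≡ (y + x + z) + 4 * (y * x + y * z + x * z)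
  rhs = solve-∀

FairGame3-swap₂₃ : ∀ x y z → FairGame3 x y z → FairGame3 x z y
FairGame3-swap₂₃ x y z game = trans (sym (lhs x y z)) (trans game (rhs x y z))
  where
  lhs : ∀ x y z → (x + y + z) * (x + y + z) ≡ (x + z + y) * (x + z + y)
  lhs = solve-∀
  rhs : ∀ x y z → (x + y + z) + 4 * (x * y + x * z + y * z) ≡ (x + z + y) + 4 * (x * z + x * y + z * y)
  rhs = solve-∀

FairGame3⇒SqrtMinus3Mod-ordered : ∀ x t z → FairGame3 x (z + t) z → SqrtMinus3Mod (2 * x + 1)
FairGame3⇒SqrtMinus3Mod-ordered x t z game =
  2 * t , ∣m+n∣m⇒∣n (subst (n ∣_) (sym n²+[2t]²+3≡4n[s+1]) (m∣m*n _)) (m∣m*n n)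
  where
  n = 2 * x + 1
  S = x + (z + t) + z
  E = x * (z + t) + x * z + (z + t) * z
  identity : ∀ x t z →
    (2 * x + 1) * (2 * x + 1) + ((2 * t) * (2 * t) + 3)
      + 4 * ((x + (z + t) + z) + 4 * (x * (z + t) + x * z + (z + t) * z))
    ≡ (2 * x + 1) * (4 * ((z + t) + z + 1)) + 4 * ((x + (z + t) + z) * (x + (z + t) + z))
  identity = solve-∀
  n²+[2t]²+3≡4n[s+1] : n * n + ((2 * t) * (2 * t) + 3) ≡ n * (4 * ((z + t) + z + 1))
  n²+[2t]²+3≡4n[s+1] = +-cancelʳ-≡ (4 * (S + 4 * E)) _ _
    (trans (identity x t z) (cong (λ m → n * (4 * ((z + t) + z + 1)) + 4 * m) game))

FairGame3⇒SqrtMinus3Mod : ∀ x y z → FairGame3 x y z → SqrtMinus3Mod (2 * x + 1)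
FairGame3⇒SqrtMinus3Mod x y z game with ≤-total z y
... | inj₁ z≤y = let (t , z+t≡y) = m≤n⇒∃[o]m+o≡n z≤y in
  FairGame3⇒SqrtMinus3Mod-ordered x t z (subst (λ y → FairGame3 x y z) (sym z+t≡y) game)
... | inj₂ y≤z = let (t , y+t≡z) = m≤n⇒∃[o]m+o≡n y≤z in
  FairGame3⇒SqrtMinus3Mod-ordered x t y
    (subst (λ z → FairGame3 x z y) (sym y+t≡z) (FairGame3-swap₂₃ x y z game))

C₃⇒SqrtMinus3Mod : ∀ c → C₃ c → SqrtMinus3Mod (2 * c + 1)
C₃⇒SqrtMinus3Mod _ (x , y , z , game , inj₁ refl)        = FairGame3⇒SqrtMinus3Mod x y z game
C₃⇒SqrtMinus3Mod _ (x , y , z , game , inj₂ (inj₁ refl)) =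
  FairGame3⇒SqrtMinus3Mod y x z (FairGame3-swap₁₂ x y z game)
C₃⇒SqrtMinus3Mod _ (x , y , z , game , inj₂ (inj₂ refl)) =
  FairGame3⇒SqrtMinus3Mod z x y (FairGame3-swap₁₂ x z y (FairGame3-swap₂₃ x y z game))

∃-quotient : ∀ c t → 2 * c + 1 ∣ (2 * t) * (2 * t) + 3 → ∃[ Q ] Q * (2 * c + 1) + c ≡ t * t + c * c
∃-quotient c t n∣[2t]²+3 with odd∣4x⇒∣x c {t * t + c * c + suc c} n∣4X
  where
  identity : ∀ c t → 4 * (t * t + c * c + suc c) ≡ (2 * c + 1) * (2 * c + 1) + ((2 * t) * (2 * t) + 3)
  identity = solve-∀
  n∣4X : 2 * c + 1 ∣ 4 * (t * t + c * c + suc c)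
  n∣4X = subst (2 * c + 1 ∣_) (sym (identity c t)) (∣m∣n⇒∣m+n (m∣m*n _) n∣[2t]²+3)
... | divides zero    X≡0       = contradiction X≡0 (m+1+n≢0 (t * t + c * c))
... | divides (suc Q) X≡[1+Q]n = Q , +-cancelʳ-≡ (suc c) _ _ (trans (identity Q c) (sym X≡[1+Q]n))
  where
  identity : ∀ Q c → Q * (2 * c + 1) + c + suc c ≡ suc Q * (2 * c + 1)
  identity = solve-∀

quotient-parity : ∀ c t Q → Q * (2 * c + 1) + c ≡ t * t + c * c → 2 ∣ Q + t
quotient-parity c t Q eq = ∣m+n∣m⇒∣n 2∣2[Qc+c]+Q+t (m∣m*n (Q * c + c))
  where
  identity₁ : ∀ Q c t → 2 * (Q * c + c) + (Q + t) ≡ Q * (2 * c + 1) + c + t + c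
  identity₁ = solve-∀
  identity₂ : ∀ c t → t * t + c * c + t + c ≡ t * suc t + c * suc c
  identity₂ = solve-∀
  2∣2[Qc+c]+Q+t : 2 ∣ 2 * (Q * c + c) + (Q + t)
  2∣2[Qc+c]+Q+t =
    subst (2 ∣_) (sym (trans (identity₁ Q c t) (trans (cong (λ m → m + t + c) eq) (identity₂ c t))))
          (∣m∣n⇒∣m+n (2∣n*[1+n] t) (2∣n*[1+n] c))

quotient-≥ : ∀ c t Q → 2 * c + 1 ≤ t → Q * (2 * c + 1) + c ≡ t * t + c * c → t ≤ Q
quotient-≥ c t Q n≤t eq = *-cancelʳ-≤ t Q (2 * c + 1) {{odd-nonZero c}} (+-cancelʳ-≤ c _ _ (begin
  t * (2 * c + 1) + c   ≤⟨ +-mono-≤ (*-monoʳ-≤ t n≤t) (m≤m*m c) ⟩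
  t * t + c * c         ≡⟨ eq ⟨
  Q * (2 * c + 1) + c   ∎))
  where
  open ≤-Reasoning
  m≤m*m : ∀ m → m ≤ m * m
  m≤m*m zero    = z≤n
  m≤m*m (suc m) = m≤m*n (suc m) (suc m)

FairGame3-from-quotient : ∀ c t u → (2 * u + t) * (2 * c + 1) + c ≡ t * t + c * c → FairGame3 c (u + t) u
FairGame3-from-quotient c t u eq = +-cancelʳ-≡ (t * t + c * c) _ _ (begin
  S * S + (t * t + c * c)                   ≡⟨ cong (S * S +_) eq ⟨
  S * S + ((2 * u + t) * (2 * c + 1) + c)   ≡⟨ identity c t u ⟩
  S + 4 * E + (t * t + c * c)               ∎)
  where
  open ≡-Reasoning
  S = c + (u + t) + u
  E = c * (u + t) + c * u + (u + t) * u
  identity : ∀ c t u → (c + (u + t) + u) * (c + (u + t) + u) + ((2 * u + t) * (2 * c + 1) + c)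
                     ≡ (c + (u + t) + u) + 4 * (c * (u + t) + c * u + (u + t) * u) + (t * t + c * c)
  identity = solve-∀

large-even-root⇒C₃ : ∀ c t → 2 * c + 1 ≤ t → 2 * c + 1 ∣ (2 * t) * (2 * t) + 3 → C₃ c
large-even-root⇒C₃ c t n≤t n∣[2t]²+3 =
  let (Q , eq) = ∃-quotient c t n∣[2t]²+3
      (d , t+d≡Q) = m≤n⇒∃[o]m+o≡n (quotient-≥ c t Q n≤t eq)
      divides u d≡u*2 = ∣m+n∣m⇒∣n (subst (2 ∣_) (identity₁ t d)
                          (subst (λ Q → 2 ∣ Q + t) (sym t+d≡Q) (quotient-parity c t Q eq))) (m∣m*n t)
      Q≡2u+t = trans (sym t+d≡Q) (trans (cong (t +_) d≡u*2) (identity₂ t u))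
  in c , u + t , u , FairGame3-from-quotient c t u (subst (λ Q → Q * (2 * c + 1) + c ≡ t * t + c * c) Q≡2u+t eq)
   , inj₁ refl
  where
  identity₁ : ∀ t d → t + d + t ≡ 2 * t + d
  identity₁ = solve-∀
  identity₂ : ∀ t u → t + u * 2 ≡ 2 * u + t
  identity₂ = solve-∀

-- 2t = a + (2c + 1)(a + 2) is an even root at least 2c + 1.
SqrtMinus3Mod⇒C₃ : ∀ c → SqrtMinus3Mod (2 * c + 1) → C₃ c
SqrtMinus3Mod⇒C₃ c (a , n∣a²+3) = large-even-root⇒C₃ c t (m≤n+m (2 * c + 1) ((c + 1) * a))
  (subst (λ b → 2 * c + 1 ∣ b * b + 3) (identity c a) (∣sq+3-shift (2 * c + 1) a (a + 2) n∣a²+3))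
  where
  t = (c + 1) * a + (2 * c + 1)
  identity : ∀ c a → a + (2 * c + 1) * (a + 2) ≡ 2 * ((c + 1) * a + (2 * c + 1))
  identity = solve-∀

-- Odd moduli with a square root of -3

prime-SqrtMinus3Mod : ∀ {p} → Prime p → p ≢ 2 → SqrtMinus3Mod p → p ≡ 3 ⊎ p % 3 ≡ 1
prime-SqrtMinus3Mod {p} p-prime p≢2 root with p ≟ 3
... | yes p≡3 = inj₁ p≡3
... | no  p≢3 = inj₂ (ModPrime.SqrtMinus3Mod⇒≡1mod3 p-prime p≢2 p≢3 root)

odd-SqrtMinus3Mod-prime-factor : ∀ c {q} → SqrtMinus3Mod (2 * c + 1) →
                                 Prime q → q ∣ 2 * c + 1 → q ≡ 3 ⊎ q % 3 ≡ 1
odd-SqrtMinus3Mod-prime-factor c root q-prime q∣n =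
  prime-SqrtMinus3Mod q-prime (λ { refl → 2∤odd c q∣n }) (SqrtMinus3Mod-∣ q∣n root)

3∣sq+3⇒3∣a : ∀ a → 3 ∣ a * a + 3 → 3 ∣ a
3∣sq+3⇒3∣a a 3∣a²+3 =
  [ id , id ]′ (euclidsLemma a a prime-3 (∣m+n∣m⇒∣n (subst (3 ∣_) (+-comm (a * a) 3) 3∣a²+3) ∣-refl))

9∤[3s]²+3 : ∀ s → ¬ 9 ∣ (s * 3) * (s * 3) + 3
9∤[3s]²+3 s 9∣[3s]²+3 =
  contradiction (∣⇒≤ (∣m+n∣m⇒∣n (subst (9 ∣_) (identity s) 9∣[3s]²+3) (n∣m*n (s * s))))
                λ { (s≤s (s≤s (s≤s ()))) }
  where
  identity : ∀ s → s * 3 * (s * 3) + 3 ≡ s * s * 9 + 3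
  identity = solve-∀

9∤sq+3 : ∀ a → ¬ 9 ∣ a * a + 3
9∤sq+3 a 9∣a²+3 with 3∣sq+3⇒3∣a a (∣-trans (divides 3 refl) 9∣a²+3)
... | divides s refl = 9∤[3s]²+3 s 9∣a²+3

odd-SqrtMinus3Mod⇒P₁⊎ThreeP₁ : ∀ c → SqrtMinus3Mod (2 * c + 1) → P₁ (2 * c + 1) ⊎ ThreeP₁ (2 * c + 1)
odd-SqrtMinus3Mod⇒P₁⊎ThreeP₁ c root with 3 ∣? 2 * c + 1
... | no 3∤n = inj₁ (m≤n+m 1 (2 * c) , λ q q-prime q∣n →
  [ (λ { refl → contradiction q∣n 3∤n }) , id ]′ (odd-SqrtMinus3Mod-prime-factor c root q-prime q∣n))
... | yes (divides k n≡k*3) = inj₂ (k , (1≤k , k-factors) , trans n≡k*3 (*-comm k 3))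
  where
  1≤k : 1 ≤ k
  1≤k = n≢0⇒n>0 λ { refl → m+1+n≢0 (2 * c) n≡k*3 }
  k∣n : k ∣ 2 * c + 1
  k∣n = subst (k ∣_) (sym n≡k*3) (m∣m*n 3)
  9∤n : ¬ 9 ∣ 2 * c + 1
  9∤n 9∣n = let (a , n∣a²+3) = root in 9∤sq+3 a (∣-trans 9∣n n∣a²+3)
  k-factors : ∀ q → Prime q → q ∣ k → q % 3 ≡ 1
  k-factors q q-prime q∣k =
    [ (λ { refl → ⊥-elim (9∤n (subst (9 ∣_) (sym n≡k*3) (*-monoˡ-∣ 3 q∣k))) }) , id ]′
      (odd-SqrtMinus3Mod-prime-factor c root q-prime (∣-trans q∣k k∣n))

≡1mod3⇒≢2 : ∀ {p} → p % 3 ≡ 1 → p ≢ 2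
≡1mod3⇒≢2 () refl

≡1mod3⇒≢3 : ∀ {p} → p % 3 ≡ 1 → p ≢ 3
≡1mod3⇒≢3 () refl

product-SqrtMinus3Mod : ∀ {ps} → All Prime ps → (∀ {p} → p ∈ ps → p % 3 ≡ 1) →
                        SqrtMinus3Mod (product ps)
product-SqrtMinus3Mod []                 _   = 0 , 1∣ 3
product-SqrtMinus3Mod (p-prime ∷ primes) ≡1 =
  ModPrime.SqrtMinus3Mod-* p-prime (≡1mod3⇒≢2 p≡1) (≡1mod3⇒≢3 p≡1)
    (ModPrime.≡1mod3⇒SqrtMinus3Mod p-prime p≡1) (product-SqrtMinus3Mod primes (≡1 ∘ there))
  where p≡1 = ≡1 (here refl)

P₁⇒SqrtMinus3Mod : ∀ {n} → P₁ n → SqrtMinus3Mod n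
P₁⇒SqrtMinus3Mod {n} (n≥1 , ≡1) = subst SqrtMinus3Mod (sym isFactorisation)
  (product-SqrtMinus3Mod factorsPrime λ p∈ →
    ≡1 _ (All.lookup factorsPrime p∈) (subst (_ ∣_) (sym isFactorisation) (∈⇒∣product p∈)))
  where open PrimeFactorisation (factorise n {{>-nonZero n≥1}})

ThreeP₁⇒SqrtMinus3Mod : ∀ {n} → ThreeP₁ n → SqrtMinus3Mod n
ThreeP₁⇒SqrtMinus3Mod (k , P₁[k]@(_ , ≡1) , refl) =
  ModPrime.SqrtMinus3Mod-*-coprime prime-3 (λ 3∣k → 0≢1 (≡1 3 prime-3 3∣k))
    (0 , ∣-refl) (P₁⇒SqrtMinus3Mod P₁[k])
  where
  0≢1 : 0 ≢ 1
  0≢1 ()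

theorem5p4 : ∀ (c : ℕ) → C₃ c ⇔ (P₁ (2 * c + 1) ⊎ ThreeP₁ (2 * c + 1))
theorem5p4 c = mk⇔ (odd-SqrtMinus3Mod⇒P₁⊎ThreeP₁ c ∘ C₃⇒SqrtMinus3Mod c)
                   (SqrtMinus3Mod⇒C₃ c ∘ [ P₁⇒SqrtMinus3Mod , ThreeP₁⇒SqrtMinus3Mod ]′)
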